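{- Let $d \geq 1$, $n \geq 1$ and $k \geq 0$ be integers with $2 n^{d-k-1} > 3^d - 1$. Then no placement of $n^k$ queens in the $d$-dimensional chess space of size $n$ attacks all board positions.
   Context: A $d$-dimensional chess space of size $n$ is the set of positions $\{0,1,\ldots,n-1\}^d$. A queen at position $q$ attacks a position $x$ of the board if $x = q + s\delta$ for some integer $s$ and some $\delta \in \{ -1,0,1\}^d$ other than the zero vector (in particular a queen attacks the position it occupies). A placement of queens attacks all board positions if every position is attacked by at least one queen. -}

module Defs where

open import Data.Nat using (ℕ)
open import Data.Fin using (Fin)
open import Data.Integer using (ℤ; +_; _+_; _*_; -[1+_])
open import Data.Product using (Σ; ∃; _×_)
open import Relation.Binary.PropositionalEquality using (_≡_)
open import Relation.Nullary using (¬_)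
import Data.Fin as Fin

Position : ℕ → ℕ → Set
Position d n = Fin d → Fin n

coord : ∀ {d n} → Position d n → Fin d → ℤ
coord p i = + Fin.toℕ (p i)

data Unit3 : Set where
  minus zero plus : Unit3

unitℤ : Unit3 → ℤ
unitℤ minus = -[1+ 0 ]
unitℤ zero  = + 0
unitℤ plus  = + 1

Direction : ℕ → Set
Direction d = Fin d → Unit3

NonZeroDir : ∀ {d} → Direction d → Set
NonZeroDir {d} δ = ¬ (∀ i → δ i ≡ zero)

Attacks : ∀ {d n} → Position d n → Position d n → Set
Attacks {d} q x =
  Σ ℤ λ s → Σ (Direction d) λ δ →
    NonZeroDir δ × (∀ i → coord x i ≡ coord q i + s * unitℤ (δ i))

Placement : ℕ → ℕ → ℕ → Set
Placement m d n = Fin m → Position d n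

AttacksAll : ∀ {m d n} → Placement m d n → Set
AttacksAll {m} {d} {n} Q = ∀ (x : Position d n) → ∃ λ (j : Fin m) → Attacks (Q j) x

-- A queen attacks exactly the positions on the (3^d − 1)/2 lines through it.  Orienting
-- each line so that the first nonzero entry of its direction is +1, a position on the line
-- is determined by its coordinate at that index, so each line meets the board in at most n
-- positions.  Hence n^k queens attack at most n^k · n · (3^d − 1)/2 positions, and the
-- hypothesis makes this fewer than the n^d positions of the board.
module Submission where

open import Defs
open import Data.Nat using (ℕ; zero; suc; NonZero; >-nonZero; _≤_; _<_; _*_; _^_; _∸_; _+_; s<s; _<?_)
open import Data.Nat.Properties
  using (*-distribˡ-+; +-suc; +-comm; m^n>0; m^n≢0; m≤m+n; ≤-trans; <⇒≱;
         *-cancelˡ-<; *-monoʳ-<; ^-distribˡ-+-*; m≤n⇒m∸n≡0; ≮⇒≥; module ≤-Reasoning)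
open import Data.Fin using (Fin; zero; suc; toℕ; _↑ˡ_; _↑ʳ_; splitAt; combine)
open import Data.Fin.Base using (finToFun; funToFin)
open import Data.Fin.Properties
  using (↑ˡ-injective; ↑ʳ-injective; splitAt-↑ˡ; splitAt-↑ʳ; combine-injective;
         finToFun-funToFin; funToFin-finToFin; pigeonhole; <⇒≢; toℕ-injective)
open import Data.Integer using (ℤ; -1ℤ; 1ℤ)
  renaming (_+_ to _+ℤ_; _*_ to _*ℤ_; +_ to pos)
open import Data.Integer.Properties
  using (+-0-abelianGroup; +-injective; *-identityˡ; *-identityʳ; *-zeroʳ; *-assoc)
open import Algebra.Properties.AbelianGroup +-0-abelianGroup using (∙-cancelˡ)
open import Data.Product using (Σ; _,_)
open import Data.Empty using (⊥-elim)
open import Relation.Nullary using (¬_; yes; no)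
open import Relation.Binary.PropositionalEquality

private
  variable
    d m n : ℕ

neg : Unit3 → Unit3
neg minus = plus
neg zero  = zero
neg plus  = minus

unitℤ-neg : ∀ u → unitℤ u ≡ -1ℤ *ℤ unitℤ (neg u)
unitℤ-neg minus = refl
unitℤ-neg zero  = refl
unitℤ-neg plus  = refl

toFin3 : Unit3 → Fin 3
toFin3 minus = zero
toFin3 zero  = suc zero
toFin3 plus  = suc (suc zero)

fromFin3 : Fin 3 → Unit3
fromFin3 zero             = minus
fromFin3 (suc zero)       = zero
fromFin3 (suc (suc zero)) = plus

fromFin3-toFin3 : ∀ u → fromFin3 (toFin3 u) ≡ u
fromFin3-toFin3 minus = refl
fromFin3-toFin3 zero  = refl
fromFin3-toFin3 plus  = refl

encodeDirection : Direction d → Fin (3 ^ d)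
encodeDirection δ = funToFin (λ i → toFin3 (δ i))

decodeDirection : Fin (3 ^ d) → Direction d
decodeDirection c i = fromFin3 (finToFun c i)

decode-encodeDirection : (δ : Direction d) → ∀ i → decodeDirection (encodeDirection δ) i ≡ δ i
decode-encodeDirection δ i =
  trans (cong fromFin3 (finToFun-funToFin (λ j → toFin3 (δ j)) i)) (fromFin3-toFin3 (δ i))

funToFin-cong : {f g : Fin d → Fin n} → (∀ i → f i ≡ g i) → funToFin f ≡ funToFin g
funToFin-cong {zero}  f≗g = refl
funToFin-cong {suc d} f≗g = cong₂ combine (f≗g zero) (funToFin-cong (λ i → f≗g (suc i)))

finToFun-injective : (i j : Fin (n ^ d)) →
  (∀ k → finToFun {n} {d} i k ≡ finToFun j k) → i ≡ j
finToFun-injective {n} {d} i j same = trans (sym (funToFin-finToFin {d} {n} i))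
  (trans (funToFin-cong same) (funToFin-finToFin {d} {n} j))

-- A line through the origin, given by its direction whose first nonzero entry is +1:
-- either that entry is the first one and the rest of the direction is arbitrary, or the
-- first entry is 0.  The rest of the direction is stored as its code in Fin (3 ^ d) so that
-- lines can be compared for equality without function extensionality.
data Line : ℕ → Set where
  leading : Fin (3 ^ d) → Line (suc d)
  later   : Line d → Line (suc d)

direction : Line d → Direction d
direction (leading c) zero    = plus
direction (leading c) (suc i) = decodeDirection c i
direction (later ℓ)   zero    = zero
direction (later ℓ)   (suc i) = direction ℓ i

pivot : Line d → Fin d
pivot (leading c) = zero
pivot (later ℓ)   = suc (pivot ℓ)

direction-pivot : (ℓ : Line d) → direction ℓ (pivot ℓ) ≡ plus
direction-pivot (leading c) = refl
direction-pivot (later ℓ)   = direction-pivot ℓ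

lineCount : ℕ → ℕ
lineCount zero    = 0
lineCount (suc d) = 3 ^ d + lineCount d

lineIndex : Line d → Fin (lineCount d)
lineIndex {suc d} (leading c) = c ↑ˡ lineCount d
lineIndex {suc d} (later ℓ)   = 3 ^ d ↑ʳ lineIndex ℓ

lineIndex-injective : (ℓ ℓ′ : Line d) → lineIndex ℓ ≡ lineIndex ℓ′ → ℓ ≡ ℓ′
lineIndex-injective (leading c) (leading c′) eq = cong leading (↑ˡ-injective _ c c′ eq)
lineIndex-injective (later ℓ)   (later ℓ′)   eq =
  cong later (lineIndex-injective ℓ ℓ′ (↑ʳ-injective _ _ _ eq))
lineIndex-injective {suc d} (leading c) (later ℓ′) eq
  with trans (sym (splitAt-↑ˡ (3 ^ d) c _)) (trans (cong (splitAt _) eq) (splitAt-↑ʳ _ _ _))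
... | ()
lineIndex-injective {suc d} (later ℓ) (leading c′) eq
  with trans (sym (splitAt-↑ʳ (3 ^ d) _ _)) (trans (cong (splitAt _) eq) (splitAt-↑ˡ _ c′ _))
... | ()

suc[2*lineCount]≡3^ : ∀ d → suc (2 * lineCount d) ≡ 3 ^ d
suc[2*lineCount]≡3^ zero    = refl
suc[2*lineCount]≡3^ (suc d) = begin
  suc (2 * (3 ^ d + lineCount d))      ≡⟨ cong suc (*-distribˡ-+ 2 (3 ^ d) (lineCount d)) ⟩
  suc (2 * 3 ^ d + 2 * lineCount d)    ≡⟨ +-suc (2 * 3 ^ d) (2 * lineCount d) ⟨
  2 * 3 ^ d + suc (2 * lineCount d)    ≡⟨ cong (2 * 3 ^ d +_) (suc[2*lineCount]≡3^ d) ⟩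
  2 * 3 ^ d + 3 ^ d                    ≡⟨ +-comm (2 * 3 ^ d) (3 ^ d) ⟩
  3 * 3 ^ d                            ∎
  where open ≡-Reasoning

lineCount-positive : 1 ≤ d → 0 < lineCount d
lineCount-positive {suc d} _ = ≤-trans (m^n>0 3 d) (m≤m+n (3 ^ d) (lineCount d))

Parallel : Direction d → Line d → Set
Parallel δ ℓ = Σ ℤ λ σ → ∀ i → unitℤ (δ i) ≡ σ *ℤ unitℤ (direction ℓ i)

normalise : (δ : Direction d) → NonZeroDir δ → Σ (Line d) (Parallel δ)
normalise {zero}  δ nonzero = ⊥-elim (nonzero λ ())
normalise {suc d} δ nonzero with δ zero in δ₀
... | plus  = leading (encodeDirection (λ i → δ (suc i))) , 1ℤ , λ where
  zero    → cong unitℤ δ₀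
  (suc i) → trans (cong unitℤ (sym (decode-encodeDirection _ i))) (sym (*-identityˡ _))
... | minus = leading (encodeDirection (λ i → neg (δ (suc i)))) , -1ℤ , λ where
  zero    → cong unitℤ δ₀
  (suc i) → trans (unitℤ-neg (δ (suc i)))
                  (cong (λ u → -1ℤ *ℤ unitℤ u) (sym (decode-encodeDirection _ i)))
... | zero  with normalise (λ i → δ (suc i)) (λ rest → nonzero λ { zero → δ₀ ; (suc i) → rest i })
...   | ℓ , σ , parallel = later ℓ , σ , λ where
  zero    → trans (cong unitℤ δ₀) (sym (*-zeroʳ σ))
  (suc i) → parallel i

OnLine : Position d n → Line d → Position d n → Set
OnLine {d} q ℓ x = Σ ℤ λ t → ∀ i → coord x i ≡ coord q i +ℤ t *ℤ unitℤ (direction ℓ i)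

attack⇒onLine : {q x : Position d n} → Attacks q x → Σ (Line d) λ ℓ → OnLine q ℓ x
attack⇒onLine {q = q} {x} (s , δ , nonzero , x≡q+sδ) with normalise δ nonzero
... | ℓ , σ , parallel = ℓ , s *ℤ σ , λ i → begin
  coord x i                                              ≡⟨ x≡q+sδ i ⟩
  coord q i +ℤ s *ℤ unitℤ (δ i)                          ≡⟨ cong (λ u → coord q i +ℤ s *ℤ u) (parallel i) ⟩
  coord q i +ℤ s *ℤ (σ *ℤ unitℤ (direction ℓ i))         ≡⟨ cong (coord q i +ℤ_) (*-assoc s σ _) ⟨
  coord q i +ℤ (s *ℤ σ) *ℤ unitℤ (direction ℓ i)         ∎
  where open ≡-Reasoning

onLine-pivot : {q x : Position d n} {ℓ : Line d} ((t , _) : OnLine q ℓ x) →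
  coord x (pivot ℓ) ≡ coord q (pivot ℓ) +ℤ t
onLine-pivot {q = q} {x} {ℓ} (t , x≡q+tℓ) = begin
  coord x (pivot ℓ)                                        ≡⟨ x≡q+tℓ (pivot ℓ) ⟩
  coord q (pivot ℓ) +ℤ t *ℤ unitℤ (direction ℓ (pivot ℓ))  ≡⟨ cong (λ u → coord q (pivot ℓ) +ℤ t *ℤ unitℤ u) (direction-pivot ℓ) ⟩
  coord q (pivot ℓ) +ℤ t *ℤ 1ℤ                             ≡⟨ cong (coord q (pivot ℓ) +ℤ_) (*-identityʳ t) ⟩
  coord q (pivot ℓ) +ℤ t                                   ∎
  where open ≡-Reasoning

coord-injective : (x y : Position d n) → ∀ i → coord x i ≡ coord y i → x i ≡ y i
coord-injective x y i eq = toℕ-injective (+-injective eq)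

onLine-injective : {q x y : Position d n} {ℓ : Line d} → OnLine q ℓ x → OnLine q ℓ y →
  x (pivot ℓ) ≡ y (pivot ℓ) → ∀ i → x i ≡ y i
onLine-injective {q = q} {x} {y} {ℓ} onˣ@(t , x≡q+tℓ) onʸ@(t′ , y≡q+t′ℓ) samePivot i =
  coord-injective x y i (begin
    coord x i                                    ≡⟨ x≡q+tℓ i ⟩
    coord q i +ℤ t *ℤ unitℤ (direction ℓ i)      ≡⟨ cong (λ s → coord q i +ℤ s *ℤ unitℤ (direction ℓ i)) t≡t′ ⟩
    coord q i +ℤ t′ *ℤ unitℤ (direction ℓ i)     ≡⟨ y≡q+t′ℓ i ⟨
    coord y i                                    ∎)
  where
  open ≡-Reasoning
  t≡t′ : t ≡ t′
  t≡t′ = ∙-cancelˡ (coord q (pivot ℓ)) t t′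
    (trans (sym (onLine-pivot onˣ)) (trans (cong (λ a → pos (toℕ a)) samePivot) (onLine-pivot onʸ)))

Sighting : Placement m d n → Position d n → Set
Sighting {m} {d} Q x = Σ (Fin m) λ j → Σ (Line d) λ ℓ → OnLine (Q j) ℓ x

attacksAll⇒sighting : (Q : Placement m d n) → AttacksAll Q → ∀ x → Sighting Q x
attacksAll⇒sighting Q attacksAll x with attacksAll x
... | j , attack = j , attack⇒onLine attack

label : {Q : Placement m d n} {x : Position d n} → Sighting Q x → Fin (m * (n * lineCount d))
label {x = x} (j , ℓ , _) = combine j (combine (x (pivot ℓ)) (lineIndex ℓ))

label-injective : {Q : Placement m d n} {x y : Position d n}
  (sˣ : Sighting Q x) (sʸ : Sighting Q y) → label sˣ ≡ label sʸ → ∀ i → x i ≡ y i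
label-injective (j , ℓ , onˣ) (j′ , ℓ′ , onʸ) eq with combine-injective j _ j′ _ eq
... | refl , eq′ with combine-injective _ _ _ _ eq′
...   | samePivot , sameIndex with lineIndex-injective ℓ ℓ′ sameIndex
...     | refl = onLine-injective onˣ onʸ samePivot

attacksAll⇒n^d≤m*[n*lineCount] : (Q : Placement m d n) → AttacksAll Q → n ^ d ≤ m * (n * lineCount d)
attacksAll⇒n^d≤m*[n*lineCount] {m} {d} {n} Q attacksAll = ≮⇒≥ λ fewer →
  let (i , i′ , i<i′ , sameLabel) = pigeonhole fewer (λ i → label (sighting i))
  in <⇒≢ i<i′ (finToFun-injective i i′ (label-injective (sighting i) (sighting i′) sameLabel))
  where
  sighting : (i : Fin (n ^ d)) → Sighting Q (finToFun i)
  sighting i = attacksAll⇒sighting Q attacksAll (finToFun i)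

m+suc[n∸m∸1]≡n : ∀ {k d} → k < d → k + suc (d ∸ k ∸ 1) ≡ d
m+suc[n∸m∸1]≡n {zero}  {suc d} _         = refl
m+suc[n∸m∸1]≡n {suc k} {suc d} (s<s k<d) = cong suc (m+suc[n∸m∸1]≡n k<d)

lineCount<n^ : ∀ d n e → 3 ^ d ∸ 1 < 2 * n ^ e → lineCount d < n ^ e
lineCount<n^ d n e hyp =
  *-cancelˡ-< 2 _ _ (subst (_< 2 * n ^ e) (cong (_∸ 1) (sym (suc[2*lineCount]≡3^ d))) hyp)

n^k*[n*lineCount]<n^d : ∀ d n k .{{_ : NonZero n}} → 1 ≤ d →
  lineCount d < n ^ (d ∸ k ∸ 1) → n ^ k * (n * lineCount d) < n ^ d
n^k*[n*lineCount]<n^d d n k 1≤d lines< with k <? d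
... | yes k<d = begin-strict
  n ^ k * (n * lineCount d)  <⟨ *-monoʳ-< (n ^ k) {{m^n≢0 n k}} (*-monoʳ-< n lines<) ⟩
  n ^ k * n ^ suc e          ≡⟨ ^-distribˡ-+-* n k (suc e) ⟨
  n ^ (k + suc e)            ≡⟨ cong (n ^_) (m+suc[n∸m∸1]≡n k<d) ⟩
  n ^ d                      ∎
  where
  open ≤-Reasoning
  e : ℕ
  e = d ∸ k ∸ 1
... | no k≮d = ⊥-elim (<⇒≱ lines<1 (lineCount-positive 1≤d))
  where
  lines<1 : lineCount d < 1
  lines<1 = subst (λ e → lineCount d < n ^ e) (cong (_∸ 1) (m≤n⇒m∸n≡0 (≮⇒≥ k≮d))) lines<

corollary2 : (d n k : ℕ) → 1 ≤ d → 1 ≤ n →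
    (3 ^ d) ∸ 1 < 2 * n ^ (d ∸ k ∸ 1) →
    (Q : Placement (n ^ k) d n) → ¬ AttacksAll Q
corollary2 d n k 1≤d 1≤n hyp Q attacksAll =
  <⇒≱ (n^k*[n*lineCount]<n^d d n k {{>-nonZero 1≤n}} 1≤d (lineCount<n^ d n (d ∸ k ∸ 1) hyp))
      (attacksAll⇒n^d≤m*[n*lineCount] Q attacksAll)
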